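{- For $n\ge1$ let $m_n$ denote the number of $n$-multisets of $[n]=\{1,\dots,n\}$ with no consecutive integers. Then \[\sum_{n\ge1} m_n z^n=\frac{1-3z-\sqrt{1-2z-3z^2}}{6z-2}.\]
   Context: An $n$-multiset of $[n]$ is a multiset of $n$ elements of $[n]$ (repetitions allowed), written as its non-decreasing sequence $\pi_1\le\pi_2\le\cdots\le\pi_n$. It has no consecutive integers if $\pi_{i+1}\neq\pi_i+1$ for all $i\in[n-1]$. -}

module Defs where

open import Data.Nat as ℕ using (ℕ; zero; suc; _∸_; _≤_; _≤?_)
open import Data.Nat.Properties using (_≟_)
open import Data.List using (List; []; _∷_; length; filter; map; concatMap; _++_)
open import Data.List.Relation.Unary.Linked using (Linked; linked?)
open import Data.Rational as ℚ using (ℚ; 0ℚ; 1ℚ; ½; _+_; _*_; _-_; -_; 1/_)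
import Data.Integer as ℤ
open import Relation.Binary.PropositionalEquality using (_≢_)
open import Relation.Nullary using (¬?)

range1 : ℕ → List ℕ
range1 zero    = []
range1 (suc n) = range1 n ++ (suc n ∷ [])

seqs : (n k : ℕ) → List (List ℕ)
seqs n zero    = [] ∷ []
seqs n (suc k) = concatMap (λ x → map (x ∷_) (seqs n k)) (range1 n)

-- a multiset is represented by its non-decreasing sequence
NonDecreasing : List ℕ → Set
NonDecreasing = Linked _≤_

NoConsecutive : List ℕ → Set
NoConsecutive = Linked (λ a b → b ≢ suc a)

goodMultisets : ℕ → List (List ℕ)
goodMultisets n =
  filter (λ xs → linked? (λ a b → ¬? (b ≟ suc a)) xs)
    (filter (λ xs → linked? _≤?_ xs) (seqs n n))

m : ℕ → ℕ
m n = length (goodMultisets n)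

Series : Set
Series = ℕ → ℚ

fromℕ : ℕ → ℚ
fromℕ n = ℤ.+ n ℚ./ 1

sumTo : ℕ → (ℕ → ℚ) → ℚ
sumTo zero    f = f 0
sumTo (suc n) f = sumTo n f + f (suc n)

sum1To : ℕ → (ℕ → ℚ) → ℚ
sum1To zero    f = 0ℚ
sum1To (suc n) f = sum1To n f + f (suc n)

_⊕_ : Series → Series → Series
(f ⊕ g) n = f n + g n

_⊖_ : Series → Series → Series
(f ⊖ g) n = f n - g n

_⊛_ : Series → Series → Series
(f ⊛ g) n = sumTo n (λ i → f i * g (n ∸ i))

poly : List ℚ → Series
poly []       n       = 0ℚ
poly (c ∷ cs) zero    = c
poly (c ∷ cs) (suc n) = poly cs n

at : List ℚ → ℕ → ℚ
at []       _       = 0ℚ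
at (x ∷ xs) zero    = x
at (x ∷ xs) (suc i) = at xs i

-- Square root of a series a with a 0 = 1: the unique series s with
-- s 0 = 1 and s ⊛ s = a.  sqrtUpTo a n = [s₀, …, sₙ], computed by
-- s₀ = 1,  sₙ = (aₙ - Σ_{i=1}^{n-1} sᵢ s_{n-i}) / 2.
sqrtUpTo : Series → ℕ → List ℚ
sqrtUpTo a zero    = 1ℚ ∷ []
sqrtUpTo a (suc n) =
  let p = sqrtUpTo a n in
  p ++ ((½ * (a (suc n) - sum1To n (λ i → at p i * at p (suc n ∸ i)))) ∷ [])

sqrtS : Series → Series
sqrtS a n = at (sqrtUpTo a n) n

-- Multiplicative inverse of a series b with b 0 ≠ 0:
-- t₀ = 1/b₀,  tₙ = -(Σ_{i=1}^{n} bᵢ t_{n-i}) / b₀.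
invUpTo : (b : Series) → .{{ℚ.NonZero (b 0)}} → ℕ → List ℚ
invUpTo b zero    = (1/ b 0) ∷ []
invUpTo b (suc n) =
  let p = invUpTo b n in
  p ++ ((- (1/ b 0) * sum1To (suc n) (λ i → b i * at p (suc n ∸ i))) ∷ [])

invS : (b : Series) → .{{ℚ.NonZero (b 0)}} → Series
invS b n = at (invUpTo b n) n

-- The right-hand side  (1 - 3z - √(1 - 2z - 3z²)) / (6z - 2)

rhs : Series
rhs = (poly (1ℚ ∷ ℚ.- fromℕ 3 ∷ []) ⊖ sqrtS (poly (1ℚ ∷ ℚ.- fromℕ 2 ∷ ℚ.- fromℕ 3 ∷ [])))
      ⊛ invS (poly (ℚ.- fromℕ 2 ∷ fromℕ 6 ∷ []))

lhs : Series
lhs zero    = 0ℚ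
lhs (suc n) = fromℕ (m (suc n))

-- Read a good multiset from its first entry: every later entry repeats its predecessor or
-- jumps by at least 2.  Counting the jumps gives m (k + 1) = T k 0 + T k 1, where T k h is
-- the coefficient of xʰ in (x⁻¹ + 1 + x)ᵏ.  The trinomial recurrence and the reflection
-- principle T k 0 − T k 2 = M k (Motzkin numbers) then give m (k + 2) = 3 m (k + 1) − M k.
-- On the series side, M (k + 1) = M k + Σ M i M (k − 1 − i) says exactly that
-- 1 − z − 2 Σ M k z^(k+2) squares to 1 − 2z − 3z², and 1 / (6z − 2) = −½ Σ 3ⁿ zⁿ, so the
-- coefficients of the right-hand side obey the same recurrence with the same start.
module Submission where

open import Algebra.Bundles using (CommutativeMonoid; CommutativeRing; CommutativeSemiring)
open import Data.List using (List; []; _∷_; _++_; map; concatMap; filter; length)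
import Data.List.Properties as Listₚ
open import Data.List.Relation.Unary.All using (universal)
open import Data.List.Relation.Unary.Linked as Linked using (linked?)
open import Data.Nat as ℕ using (ℕ; zero; suc; _∸_; _≤_; _<_; z≤n; s≤s; _≤?_; _<?_)
import Data.Nat.Combinatorics as Comb
open import Data.Nat.Induction using (<-rec)
open import Data.Nat.ListAction using (sum)
open import Data.Nat.ListAction.Properties using (sum-++)
import Data.Nat.Properties as ℕₚ
import Data.Nat.Coprimality as Coprimality
import Data.Integer as ℤ
import Data.Integer.Properties as ℤₚ
open import Data.Sum using (inj₁; inj₂)
import Data.Rational.Properties as ℚₚ
open import Function using (_∘_)
open import Level using (Level)
open import Relation.Binary.PropositionalEquality
  using (_≡_; _≢_; refl; sym; trans; cong; cong₂; subst; module ≡-Reasoning)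
open import Relation.Nullary using (¬_; Dec; yes; no; ¬?; _×-dec_)
open import Relation.Unary using (Pred; Decidable)
open import Defs

module Summation {c ℓ} (R : CommutativeSemiring c ℓ) where

  open CommutativeSemiring R renaming (refl to ≈-refl; sym to ≈-sym; trans to ≈-trans)
  open import Algebra.Properties.CommutativeSemigroup +-commutativeSemigroup
    using (interchange)
  open import Relation.Binary.Reasoning.Setoid setoid

  ∑< : ℕ → (ℕ → Carrier) → Carrier
  ∑< zero    f = 0#
  ∑< (suc n) f = ∑< n f + f n

  -- (f ⋆ g) n is the coefficient of zⁿ in z F(z) G(z).
  _⋆_ : (ℕ → Carrier) → (ℕ → Carrier) → ℕ → Carrier
  (f ⋆ g) n = ∑< n (λ t → f t * g (n ∸ suc t))

  ∑<-cong : ∀ n {f g} → (∀ {i} → i < n → f i ≈ g i) → ∑< n f ≈ ∑< n g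
  ∑<-cong zero    f≈g = ≈-refl
  ∑<-cong (suc n) f≈g = +-cong (∑<-cong n (f≈g ∘ ℕₚ.m<n⇒m<1+n)) (f≈g (ℕₚ.n<1+n n))

  ∑<-zero : ∀ n {f} → (∀ {i} → i < n → f i ≈ 0#) → ∑< n f ≈ 0#
  ∑<-zero zero    f≈0 = ≈-refl
  ∑<-zero (suc n) f≈0 = begin
    ∑< n _ + _ ≈⟨ +-cong (∑<-zero n (f≈0 ∘ ℕₚ.m<n⇒m<1+n)) (f≈0 (ℕₚ.n<1+n n)) ⟩
    0# + 0#    ≈⟨ +-identityˡ 0# ⟩
    0#         ∎

  ∑<-distrib-+ : ∀ n f g → ∑< n (λ i → f i + g i) ≈ ∑< n f + ∑< n g
  ∑<-distrib-+ zero    f g = ≈-sym (+-identityˡ 0#)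
  ∑<-distrib-+ (suc n) f g = begin
    ∑< n (λ i → f i + g i) + (f n + g n) ≈⟨ +-congʳ (∑<-distrib-+ n f g) ⟩
    (∑< n f + ∑< n g) + (f n + g n)       ≈⟨ interchange _ _ _ _ ⟩
    (∑< n f + f n) + (∑< n g + g n)       ∎

  ∑<-distribˡ : ∀ n x f → ∑< n (λ i → x * f i) ≈ x * ∑< n f
  ∑<-distribˡ zero    x f = ≈-sym (zeroʳ x)
  ∑<-distribˡ (suc n) x f = begin
    ∑< n (λ i → x * f i) + x * f n ≈⟨ +-congʳ (∑<-distribˡ n x f) ⟩
    x * ∑< n f + x * f n           ≈⟨ distribˡ x _ _ ⟨
    x * (∑< n f + f n)             ∎

  ∑<-distribʳ : ∀ n x f → ∑< n (λ i → f i * x) ≈ ∑< n f * x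
  ∑<-distribʳ n x f = begin
    ∑< n (λ i → f i * x) ≈⟨ ∑<-cong n (λ _ → *-comm _ x) ⟩
    ∑< n (λ i → x * f i) ≈⟨ ∑<-distribˡ n x f ⟩
    x * ∑< n f           ≈⟨ *-comm x _ ⟩
    ∑< n f * x           ∎

  ∑<-sucˡ : ∀ n f → ∑< (suc n) f ≈ f 0 + ∑< n (f ∘ suc)
  ∑<-sucˡ zero    f = ≈-trans (+-identityˡ (f 0)) (≈-sym (+-identityʳ (f 0)))
  ∑<-sucˡ (suc n) f = ≈-trans (+-congʳ (∑<-sucˡ n f)) (+-assoc (f 0) _ _)

  ∑<-split : ∀ m n f → ∑< (m ℕ.+ n) f ≈ ∑< m f + ∑< n (λ j → f (m ℕ.+ j))
  ∑<-split m zero    f = begin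
    ∑< (m ℕ.+ 0) f ≡⟨ cong (λ k → ∑< k f) (ℕₚ.+-identityʳ m) ⟩
    ∑< m f         ≈⟨ +-identityʳ _ ⟨
    ∑< m f + 0#    ∎
  ∑<-split m (suc n) f = begin
    ∑< (m ℕ.+ suc n) f                                        ≡⟨ cong (λ k → ∑< k f) (ℕₚ.+-suc m n) ⟩
    ∑< (m ℕ.+ n) f + f (m ℕ.+ n)                              ≈⟨ +-congʳ (∑<-split m n f) ⟩
    (∑< m f + ∑< n (λ j → f (m ℕ.+ j))) + f (m ℕ.+ n)         ≈⟨ +-assoc _ _ _ ⟩
    ∑< m f + (∑< n (λ j → f (m ℕ.+ j)) + f (m ℕ.+ n))         ∎

  ∑<-reverse : ∀ n f → ∑< n (λ i → f (n ∸ suc i)) ≈ ∑< n f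
  ∑<-reverse zero    f = ≈-refl
  ∑<-reverse (suc n) f = begin
    ∑< (suc n) (λ i → f (n ∸ i))     ≈⟨ ∑<-sucˡ n _ ⟩
    f n + ∑< n (λ i → f (n ∸ suc i)) ≈⟨ +-congˡ (∑<-reverse n f) ⟩
    f n + ∑< n f                     ≈⟨ +-comm _ _ ⟩
    ∑< n f + f n                     ∎

  ∑<-comm : ∀ m n (f : ℕ → ℕ → Carrier) →
            ∑< m (λ i → ∑< n (f i)) ≈ ∑< n (λ j → ∑< m (λ i → f i j))
  ∑<-comm zero    n f = ≈-sym (∑<-zero n (λ _ → ≈-refl))
  ∑<-comm (suc m) n f = begin
    ∑< m (λ i → ∑< n (f i)) + ∑< n (f m)          ≈⟨ +-congʳ (∑<-comm m n f) ⟩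
    ∑< n (λ j → ∑< m (λ i → f i j)) + ∑< n (f m)  ≈⟨ ∑<-distrib-+ n _ _ ⟨
    ∑< n (λ j → ∑< m (λ i → f i j) + f m j)       ∎

  ∑<-triangle : ∀ n (g : ℕ → ℕ → Carrier) →
                ∑< n (λ k → ∑< k (λ t → g t (k ∸ suc t))) ≈ ∑< n (λ t → ∑< (n ∸ suc t) (g t))
  ∑<-triangle zero    g = ≈-refl
  ∑<-triangle (suc n) g = begin
    ∑< n (λ k → ∑< k (λ t → g t (k ∸ suc t))) + ∑< n (λ t → g t (n ∸ suc t))
      ≈⟨ +-congʳ (∑<-triangle n g) ⟩
    ∑< n (λ t → ∑< (n ∸ suc t) (g t)) + ∑< n (λ t → g t (n ∸ suc t))
      ≈⟨ ∑<-distrib-+ n _ _ ⟨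
    ∑< n (λ t → ∑< (suc (n ∸ suc t)) (g t))
      ≈⟨ ∑<-cong n (λ {t} t<n → reflexive (cong (λ k → ∑< k (g t)) (sym (ℕₚ.+-∸-assoc 1 t<n)))) ⟩
    ∑< n (λ t → ∑< (n ∸ t) (g t))
      ≈⟨ +-identityʳ _ ⟨
    ∑< n (λ t → ∑< (n ∸ t) (g t)) + 0#
      ≡⟨ cong (λ k → ∑< n (λ t → ∑< (n ∸ t) (g t)) + ∑< k (g n)) (ℕₚ.n∸n≡0 n) ⟨
    ∑< (suc n) (λ t → ∑< (suc n ∸ suc t) (g t))
      ∎

  ⋆-assoc : ∀ f g h n → ((f ⋆ g) ⋆ h) n ≈ (f ⋆ (g ⋆ h)) n
  ⋆-assoc f g h n = begin
    ∑< n (λ k → ∑< k (λ t → f t * g (k ∸ suc t)) * h (n ∸ suc k))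
      ≈⟨ ∑<-cong n (λ {k} _ → ≈-sym (∑<-distribʳ k _ _)) ⟩
    ∑< n (λ k → ∑< k (λ t → (f t * g (k ∸ suc t)) * h (n ∸ suc k)))
      ≈⟨ ∑<-cong n (λ {k} _ → ∑<-cong k (λ {t} t<k →
           reflexive (cong (λ j → (f t * g (k ∸ suc t)) * h (n ∸ suc j))
                           (sym (ℕₚ.m+[n∸m]≡n t<k))))) ⟩
    ∑< n (λ k → ∑< k (λ t → G t (k ∸ suc t)))
      ≈⟨ ∑<-triangle n G ⟩
    ∑< n (λ t → ∑< (n ∸ suc t) (G t))
      ≈⟨ ∑<-cong n (λ {t} _ → ∑<-cong (n ∸ suc t) (λ {u} _ → begin
           (f t * g u) * h (n ∸ suc (suc t ℕ.+ u))
             ≡⟨ cong (λ j → (f t * g u) * h (n ∸ j)) (ℕₚ.+-suc (suc t) u) ⟨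
           (f t * g u) * h (n ∸ (suc t ℕ.+ suc u))
             ≡⟨ cong (λ j → (f t * g u) * h j) (ℕₚ.∸-+-assoc n (suc t) (suc u)) ⟨
           (f t * g u) * h (n ∸ suc t ∸ suc u)
             ≈⟨ *-assoc _ _ _ ⟩
           f t * (g u * h (n ∸ suc t ∸ suc u))
             ∎)) ⟩
    ∑< n (λ t → ∑< (n ∸ suc t) (λ u → f t * (g u * h (n ∸ suc t ∸ suc u))))
      ≈⟨ ∑<-cong n (λ {t} _ → ∑<-distribˡ (n ∸ suc t) (f t) _) ⟩
    ∑< n (λ t → f t * (g ⋆ h) (n ∸ suc t))
      ∎
    where
    G : ℕ → ℕ → Carrier
    G t u = (f t * g u) * h (n ∸ suc (suc t ℕ.+ u))

  ⋆-congˡ : ∀ {f f′} g n → (∀ {i} → i < n → f i ≈ f′ i) → (f ⋆ g) n ≈ (f′ ⋆ g) n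
  ⋆-congˡ g n f≈f′ = ∑<-cong n (λ i<n → *-congʳ (f≈f′ i<n))

module ℕΣ = Summation ℕₚ.+-*-commutativeSemiring

module Combinatorics where

  open import Data.Nat using (_+_; _*_)
  open import Data.Product using (_×_; _,_)
  open import Data.Nat.Solver using (module +-*-Solver)
  open +-*-Solver using (solve; _:+_; _:*_; _:=_; con)
  open ℕΣ
  open ≡-Reasoning

  infix 8 _C_

  -- Opaque, so that unification never unfolds the library's definition of binomials.
  opaque
    _C_ : ℕ → ℕ → ℕ
    _C_ = Comb._C_

  opaque
    unfolding _C_

    nC0≡1 : ∀ n → n C 0 ≡ 1
    nC0≡1 n = trans (Comb.nCk≡nC[n∸k] {0} {n} z≤n) (Comb.nCn≡1 n)

    pascal : ∀ n k → suc n C suc k ≡ n C k + n C suc k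
    pascal n k = sym (Comb.nCk+nC[k+1]≡[n+1]C[k+1] n k)

    k>n⇒nCk≡0 : ∀ {n k} → n < k → n C k ≡ 0
    k>n⇒nCk≡0 = Comb.k>n⇒nCk≡0

  ∑<-pascal : ∀ n (g : ℕ → ℕ) →
    ∑< (suc (suc n)) (λ d → suc n C d * g d)
      ≡ ∑< (suc n) (λ d → n C d * g d) + ∑< (suc n) (λ d → n C d * g (suc d))
  ∑<-pascal n g = begin
    ∑< (suc (suc n)) (λ d → suc n C d * g d)
      ≡⟨ ∑<-sucˡ (suc n) (λ d → suc n C d * g d) ⟩
    suc n C 0 * g 0 + ∑< (suc n) (λ d → suc n C suc d * g (suc d))
      ≡⟨ cong₂ _+_ (cong (_* g 0) (trans (nC0≡1 (suc n)) (sym (nC0≡1 n)))) split ⟩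
    n C 0 * g 0 + (shifted + raised)
      ≡⟨ solve 3 (λ x a b → x :+ (a :+ b) := (x :+ b) :+ a) refl (n C 0 * g 0) shifted raised ⟩
    n C 0 * g 0 + raised + shifted
      ≡⟨ cong (_+ shifted) unsplit ⟩
    ∑< (suc n) (λ d → n C d * g d) + shifted
      ∎
    where
    shifted raised : ℕ
    shifted = ∑< (suc n) (λ d → n C d * g (suc d))
    raised  = ∑< (suc n) (λ d → n C suc d * g (suc d))
    split : ∑< (suc n) (λ d → suc n C suc d * g (suc d)) ≡ shifted + raised
    split = trans (∑<-cong (suc n) (λ {d} _ → trans (cong (_* g (suc d)) (pascal n d))
                                                    (ℕₚ.*-distribʳ-+ (g (suc d)) (n C d) _)))
                  (∑<-distrib-+ (suc n) (λ d → n C d * g (suc d)) (λ d → n C suc d * g (suc d)))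
    unsplit : n C 0 * g 0 + raised ≡ ∑< (suc n) (λ d → n C d * g d)
    unsplit = begin
      n C 0 * g 0 + raised                ≡⟨ ∑<-sucˡ (suc n) (λ d → n C d * g d) ⟨
      below + n C suc n * g (suc n)       ≡⟨ cong (λ x → below + x * g (suc n)) (k>n⇒nCk≡0 (ℕₚ.n<1+n n)) ⟩
      below + 0                           ≡⟨ ℕₚ.+-identityʳ below ⟩
      below                               ∎
      where
      below : ℕ
      below = ∑< (suc n) (λ d → n C d * g d)

  ∑<-hockey : ∀ n k → ∑< n (λ j → (j ∸ k) C k) ≡ (n ∸ k) C suc k
  ∑<-hockey zero    k = sym (trans (cong (_C suc k) (ℕₚ.0∸n≡0 k)) (k>n⇒nCk≡0 (s≤s z≤n)))
  ∑<-hockey (suc n) k with k ≤? n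
  ... | yes k≤n = begin
    ∑< n (λ j → (j ∸ k) C k) + (n ∸ k) C k  ≡⟨ cong (_+ (n ∸ k) C k) (∑<-hockey n k) ⟩
    (n ∸ k) C suc k + (n ∸ k) C k           ≡⟨ ℕₚ.+-comm ((n ∸ k) C suc k) ((n ∸ k) C k) ⟩
    (n ∸ k) C k + (n ∸ k) C suc k           ≡⟨ pascal (n ∸ k) k ⟨
    suc (n ∸ k) C suc k                     ≡⟨ cong (_C suc k) (ℕₚ.+-∸-assoc 1 k≤n) ⟨
    (suc n ∸ k) C suc k                     ∎
  ... | no k≰n = begin
    ∑< n (λ j → (j ∸ k) C k) + (n ∸ k) C k
      ≡⟨ cong₂ _+_ (∑<-hockey n k) (cong (_C k) (ℕₚ.m≤n⇒m∸n≡0 n≤k)) ⟩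
    (n ∸ k) C suc k + 0 C k
      ≡⟨ cong₂ _+_ (vanish n n≤k) (k>n⇒nCk≡0 (ℕₚ.≤-<-trans z≤n n<k)) ⟩
    0
      ≡⟨ vanish (suc n) n<k ⟨
    (suc n ∸ k) C suc k
      ∎
    where
    n<k : n < k
    n<k = ℕₚ.≰⇒> k≰n
    n≤k : n ≤ k
    n≤k = ℕₚ.<⇒≤ n<k
    vanish : ∀ j → j ≤ k → (j ∸ k) C suc k ≡ 0
    vanish j j≤k = k>n⇒nCk≡0 (s≤s (ℕₚ.≤-trans (ℕₚ.m∸n≤m j k) j≤k))

  C-suc-∸ : ∀ {n k} j → k < n → (n ∸ k) C suc j ≡ (n ∸ suc k) C j + (n ∸ suc k) C suc j
  C-suc-∸ {n} {k} j k<n = trans (cong (_C suc j) (ℕₚ.+-∸-assoc 1 k<n)) (pascal (n ∸ suc k) j)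

  nCk*[n∸k]Cj≡nCj*[n∸j]Ck : ∀ n k j → n C k * (n ∸ k) C j ≡ n C j * (n ∸ j) C k
  nCk*[n∸k]Cj≡nCj*[n∸j]Ck n zero j = begin
    n C 0 * n C j        ≡⟨ cong (_* n C j) (nC0≡1 n) ⟩
    1 * n C j            ≡⟨ ℕₚ.*-comm 1 (n C j) ⟩
    n C j * 1            ≡⟨ cong (n C j *_) (nC0≡1 (n ∸ j)) ⟨
    n C j * (n ∸ j) C 0  ∎
  nCk*[n∸k]Cj≡nCj*[n∸j]Ck n (suc k) zero = sym (nCk*[n∸k]Cj≡nCj*[n∸j]Ck n zero (suc k))
  nCk*[n∸k]Cj≡nCj*[n∸j]Ck zero (suc k) (suc j) =
    trans (cong (_* 0 C suc j) (k>n⇒nCk≡0 (s≤s z≤n)))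
          (cong (_* 0 C suc k) (sym (k>n⇒nCk≡0 (s≤s z≤n))))
  nCk*[n∸k]Cj≡nCj*[n∸j]Ck (suc n) (suc k) (suc j) = begin
    suc n C suc k * (n ∸ k) C suc j
      ≡⟨ cong (_* (n ∸ k) C suc j) (pascal n k) ⟩
    (n C k + n C suc k) * (n ∸ k) C suc j
      ≡⟨ ℕₚ.*-distribʳ-+ ((n ∸ k) C suc j) (n C k) (n C suc k) ⟩
    n C k * (n ∸ k) C suc j + n C suc k * (n ∸ k) C suc j
      ≡⟨ cong₂ _+_ (nCk*[n∸k]Cj≡nCj*[n∸j]Ck n k (suc j))
                   (trans (split k j) (cong₂ _+_ (nCk*[n∸k]Cj≡nCj*[n∸j]Ck n (suc k) j)
                                                 (nCk*[n∸k]Cj≡nCj*[n∸j]Ck n (suc k) (suc j)))) ⟩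
    α + (β + γ)
      ≡⟨ solve 3 (λ a b c → a :+ (b :+ c) := b :+ (a :+ c)) refl α β γ ⟩
    β + (α + γ)
      ≡⟨ cong (β +_) (split j k) ⟨
    n C j * (n ∸ j) C suc k + n C suc j * (n ∸ j) C suc k
      ≡⟨ ℕₚ.*-distribʳ-+ ((n ∸ j) C suc k) (n C j) (n C suc j) ⟨
    (n C j + n C suc j) * (n ∸ j) C suc k
      ≡⟨ cong (_* (n ∸ j) C suc k) (pascal n j) ⟨
    suc n C suc j * (n ∸ j) C suc k
      ∎
    where
    α β γ : ℕ
    α = n C suc j * (n ∸ suc j) C k
    β = n C j * (n ∸ j) C suc k
    γ = n C suc j * (n ∸ suc j) C suc k
    split : ∀ a b →
      n C suc a * (n ∸ a) C suc b ≡ n C suc a * (n ∸ suc a) C b + n C suc a * (n ∸ suc a) C suc b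
    split a b with a <? n
    ... | yes a<n = trans (cong (n C suc a *_) (C-suc-∸ b a<n)) (ℕₚ.*-distribˡ-+ (n C suc a) _ _)
    ... | no a≮n rewrite k>n⇒nCk≡0 (ℕₚ.≰⇒> a≮n) = refl

  -- The coefficient of xʰ in (x⁻¹ + 1 + x)ⁿ: d factors contribute x⁻¹ and h + d contribute x.
  trinomial : ℕ → ℕ → ℕ
  trinomial n h = ∑< (suc n) (λ d → n C d * (n ∸ d) C (h + d))

  trinomial-suc-suc : ∀ n h →
    trinomial (suc n) (suc h) ≡ trinomial n h + trinomial n (suc h) + trinomial n (suc (suc h))
  trinomial-suc-suc n h = begin
    trinomial (suc n) (suc h)
      ≡⟨ ∑<-pascal n (λ d → (suc n ∸ d) C (suc h + d)) ⟩
    ∑< (suc n) (λ d → n C d * (suc n ∸ d) C suc (h + d))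
      + ∑< (suc n) (λ d → n C d * (n ∸ d) C (suc h + suc d))
      ≡⟨ cong₂ _+_ stay up ⟩
    trinomial n h + trinomial n (suc h) + trinomial n (suc (suc h))
      ∎
    where
    stay : ∑< (suc n) (λ d → n C d * (suc n ∸ d) C suc (h + d)) ≡ trinomial n h + trinomial n (suc h)
    stay = trans (∑<-cong (suc n) (λ {d} d<1+n →
                    trans (cong (n C d *_) (C-suc-∸ (h + d) d<1+n)) (ℕₚ.*-distribˡ-+ (n C d) _ _)))
                 (∑<-distrib-+ (suc n) _ _)
    up : ∑< (suc n) (λ d → n C d * (n ∸ d) C (suc h + suc d)) ≡ trinomial n (suc (suc h))
    up = ∑<-cong (suc n) (λ {d} _ → cong (λ j → n C d * (n ∸ d) C j) (ℕₚ.+-suc (suc h) d))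

  ∑<-trinomial-one : ∀ n → ∑< n (λ e → n C suc e * (n ∸ suc e) C e) ≡ trinomial n 1
  ∑<-trinomial-one n = begin
    ∑< n (λ e → n C suc e * (n ∸ suc e) C e)
      ≡⟨ ∑<-cong n (λ {e} _ → nCk*[n∸k]Cj≡nCj*[n∸j]Ck n (suc e) e) ⟩
    ∑< n (λ e → n C e * (n ∸ e) C suc e)
      ≡⟨ ℕₚ.+-identityʳ _ ⟨
    ∑< n (λ e → n C e * (n ∸ e) C suc e) + 0
      ≡⟨ cong (∑< n (λ e → n C e * (n ∸ e) C suc e) +_) last ⟨
    trinomial n 1
      ∎
    where
    last : n C n * (n ∸ n) C suc n ≡ 0
    last = trans (cong (λ j → n C n * j C suc n) (ℕₚ.n∸n≡0 n))
                 (trans (cong (n C n *_) (k>n⇒nCk≡0 (s≤s z≤n))) (ℕₚ.*-zeroʳ (n C n)))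

  trinomial-suc-zero : ∀ n → trinomial (suc n) 0 ≡ trinomial n 1 + trinomial n 0 + trinomial n 1
  trinomial-suc-zero n = begin
    trinomial (suc n) 0
      ≡⟨ ∑<-pascal n (λ d → (suc n ∸ d) C d) ⟩
    ∑< (suc n) (λ d → n C d * (suc n ∸ d) C d) + ∑< (suc n) (λ d → n C d * (n ∸ d) C suc d)
      ≡⟨ cong (_+ trinomial n 1) stay ⟩
    trinomial n 1 + trinomial n 0 + trinomial n 1
      ∎
    where
    down rest : ℕ
    down = ∑< n (λ e → n C suc e * (n ∸ suc e) C e)
    rest = ∑< n (λ e → n C suc e * (n ∸ suc e) C suc e)
    stay : ∑< (suc n) (λ d → n C d * (suc n ∸ d) C d) ≡ trinomial n 1 + trinomial n 0
    stay = begin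
      ∑< (suc n) (λ d → n C d * (suc n ∸ d) C d)
        ≡⟨ ∑<-sucˡ n (λ d → n C d * (suc n ∸ d) C d) ⟩
      n C 0 * suc n C 0 + ∑< n (λ e → n C suc e * (n ∸ e) C suc e)
        ≡⟨ cong₂ _+_ (cong (n C 0 *_) (trans (nC0≡1 (suc n)) (sym (nC0≡1 n))))
                     (trans (∑<-cong n (λ {e} e<n → trans (cong (n C suc e *_) (C-suc-∸ e e<n))
                                                           (ℕₚ.*-distribˡ-+ (n C suc e) _ _)))
                            (∑<-distrib-+ n _ _)) ⟩
      n C 0 * n C 0 + (down + rest)
        ≡⟨ solve 3 (λ x a b → x :+ (a :+ b) := a :+ (x :+ b)) refl (n C 0 * n C 0) down rest ⟩
      down + (n C 0 * n C 0 + rest)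
        ≡⟨ cong₂ _+_ (∑<-trinomial-one n) (sym (∑<-sucˡ n (λ d → n C d * (n ∸ d) C d))) ⟩
      trinomial n 1 + trinomial n 0
        ∎

  trinomial-zero : ∀ h → trinomial 0 h ≡ 0 C h
  trinomial-zero h = begin
    0 C 0 * 0 C (h + 0)  ≡⟨ cong (λ j → 0 C 0 * 0 C j) (ℕₚ.+-identityʳ h) ⟩
    0 C 0 * 0 C h        ≡⟨ cong (_* 0 C h) (nC0≡1 0) ⟩
    1 * 0 C h            ≡⟨ ℕₚ.*-identityˡ (0 C h) ⟩
    0 C h                ∎

  trinomial-zero-suc : ∀ h → trinomial 0 (suc h) ≡ 0
  trinomial-zero-suc h = trans (trinomial-zero (suc h)) (k>n⇒nCk≡0 (s≤s z≤n))

  -- Motzkin paths: n steps from height 0 to height h, steps −1, 0, +1, never below 0.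
  motzkinPrefix : ℕ → ℕ → ℕ
  motzkinPrefix zero    zero    = 1
  motzkinPrefix zero    (suc h) = 0
  motzkinPrefix (suc n) zero    = motzkinPrefix n 0 + motzkinPrefix n 1
  motzkinPrefix (suc n) (suc h) = motzkinPrefix n h + motzkinPrefix n (suc h) + motzkinPrefix n (suc (suc h))

  motzkin : ℕ → ℕ
  motzkin n = motzkinPrefix n 0

  -- The reflection principle: a path reaching height −1 is reflected into one ending at −h−2,
  -- and by symmetry there are as many of those as paths ending at h + 2.
  motzkinPrefix+trinomial : ∀ n h → motzkinPrefix n h + trinomial n (suc (suc h)) ≡ trinomial n h
  motzkinPrefix+trinomial zero zero = begin
    1 + trinomial 0 2  ≡⟨ cong (1 +_) (trinomial-zero-suc 1) ⟩
    1                  ≡⟨ trans (sym (nC0≡1 0)) (sym (trinomial-zero 0)) ⟩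
    trinomial 0 0      ∎
  motzkinPrefix+trinomial zero (suc h) = trans (trinomial-zero-suc (2 + h)) (sym (trinomial-zero-suc h))
  motzkinPrefix+trinomial (suc n) zero = begin
    (p 0 + p 1) + trinomial (suc n) 2
      ≡⟨ cong (p 0 + p 1 +_) (trinomial-suc-suc n 1) ⟩
    (p 0 + p 1) + (T 1 + T 2 + T 3)
      ≡⟨ solve 5 (λ a b c d e → (a :+ b) :+ (c :+ d :+ e) := c :+ (a :+ d) :+ (b :+ e)) refl
           (p 0) (p 1) (T 1) (T 2) (T 3) ⟩
    T 1 + (p 0 + T 2) + (p 1 + T 3)
      ≡⟨ cong₂ (λ x y → T 1 + x + y) (motzkinPrefix+trinomial n 0) (motzkinPrefix+trinomial n 1) ⟩
    T 1 + T 0 + T 1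
      ≡⟨ trinomial-suc-zero n ⟨
    trinomial (suc n) 0
      ∎
    where
    p T : ℕ → ℕ
    p = motzkinPrefix n
    T = trinomial n
  motzkinPrefix+trinomial (suc n) (suc h) = begin
    (p h + p (1 + h) + p (2 + h)) + trinomial (suc n) (3 + h)
      ≡⟨ cong (p h + p (1 + h) + p (2 + h) +_) (trinomial-suc-suc n (2 + h)) ⟩
    (p h + p (1 + h) + p (2 + h)) + (T (2 + h) + T (3 + h) + T (4 + h))
      ≡⟨ solve 6 (λ a b c d e f → (a :+ b :+ c) :+ (d :+ e :+ f) := (a :+ d) :+ (b :+ e) :+ (c :+ f)) refl
           (p h) (p (1 + h)) (p (2 + h)) (T (2 + h)) (T (3 + h)) (T (4 + h)) ⟩
    (p h + T (2 + h)) + (p (1 + h) + T (3 + h)) + (p (2 + h) + T (4 + h))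
      ≡⟨ cong₂ _+_ (cong₂ _+_ (motzkinPrefix+trinomial n h) (motzkinPrefix+trinomial n (1 + h)))
                   (motzkinPrefix+trinomial n (2 + h)) ⟩
    T h + T (1 + h) + T (2 + h)
      ≡⟨ trinomial-suc-suc n h ⟨
    trinomial (suc n) (suc h)
      ∎
    where
    p T : ℕ → ℕ
    p = motzkinPrefix n
    T = trinomial n

  trinomial₀₁-suc : ∀ n →
    trinomial (suc n) 0 + trinomial (suc n) 1 + motzkin n ≡ 3 * (trinomial n 0 + trinomial n 1)
  trinomial₀₁-suc n = begin
    trinomial (suc n) 0 + trinomial (suc n) 1 + motzkin n
      ≡⟨ cong₂ (λ x y → x + y + motzkin n) (trinomial-suc-zero n) (trinomial-suc-suc n 0) ⟩
    (T 1 + T 0 + T 1) + (T 0 + T 1 + T 2) + motzkin n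
      ≡⟨ solve 4 (λ a b c m → (b :+ a :+ b) :+ (a :+ b :+ c) :+ m := con 2 :* a :+ con 3 :* b :+ (m :+ c)) refl
           (T 0) (T 1) (T 2) (motzkin n) ⟩
    2 * T 0 + 3 * T 1 + (motzkin n + T 2)
      ≡⟨ cong (2 * T 0 + 3 * T 1 +_) (motzkinPrefix+trinomial n 0) ⟩
    2 * T 0 + 3 * T 1 + T 0
      ≡⟨ solve 2 (λ a b → con 2 :* a :+ con 3 :* b :+ a := con 3 :* (a :+ b)) refl (T 0) (T 1) ⟩
    3 * (T 0 + T 1)
      ∎
    where
    T : ℕ → ℕ
    T = trinomial n

  -- Decomposition at the last up-step from height h.
  motzkinPrefix-suc : ∀ n h → motzkinPrefix n (suc h) ≡ ((λ t → motzkinPrefix t h) ⋆ motzkin) n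
  motzkinPrefix-suc = <-rec Decomposes step
    where
    Decomposes : ℕ → Set
    Decomposes n = ∀ h → motzkinPrefix n (suc h) ≡ ((λ t → motzkinPrefix t h) ⋆ motzkin) n

    step : ∀ n → (∀ {m} → m < n → Decomposes m) → Decomposes n
    step zero    _  h = refl
    step (suc n) ih h = sym (begin
      ∑< n (λ t → f t * motzkin (n ∸ t)) + f n * motzkin (n ∸ n)
        ≡⟨ cong₂ _+_ expand (trans (cong (λ j → f n * motzkin j) (ℕₚ.n∸n≡0 n))
                                   (ℕₚ.*-identityʳ (f n))) ⟩
      (f ⋆ motzkin) n + (f ⋆ (motzkin ⋆ motzkin)) n + p h
        ≡⟨ cong (λ x → (f ⋆ motzkin) n + x + p h) (sym (⋆-assoc f motzkin motzkin n)) ⟩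
      (f ⋆ motzkin) n + ((f ⋆ motzkin) ⋆ motzkin) n + p h
        ≡⟨ cong₂ (λ x y → x + y + p h) (sym (ih≤ n ℕₚ.≤-refl h))
             (trans (⋆-congˡ motzkin n (λ {k} k<n → sym (ih≤ k (ℕₚ.<⇒≤ k<n) h)))
                    (sym (ih≤ n ℕₚ.≤-refl (suc h)))) ⟩
      p (suc h) + p (suc (suc h)) + p h
        ≡⟨ solve 3 (λ a b c → b :+ c :+ a := a :+ b :+ c) refl (p h) (p (suc h)) (p (suc (suc h))) ⟩
      p h + p (suc h) + p (suc (suc h))
        ∎)
      where
      p : ℕ → ℕ
      p = motzkinPrefix n
      f : ℕ → ℕ
      f t = motzkinPrefix t h
      ih≤ : ∀ m → m ≤ n → Decomposes m
      ih≤ m m≤n = ih (s≤s m≤n)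
      motzkin-suc< : ∀ {t} → t < n → motzkin (n ∸ t) ≡ motzkin (n ∸ suc t) + (motzkin ⋆ motzkin) (n ∸ suc t)
      motzkin-suc< {t} t<n = trans (cong motzkin (ℕₚ.+-∸-assoc 1 t<n))
        (cong (motzkin (n ∸ suc t) +_) (ih≤ (n ∸ suc t) (ℕₚ.m∸n≤m n (suc t)) 0))
      expand : ∑< n (λ t → f t * motzkin (n ∸ t)) ≡ (f ⋆ motzkin) n + (f ⋆ (motzkin ⋆ motzkin)) n
      expand = trans (∑<-cong n (λ {t} t<n → trans (cong (f t *_) (motzkin-suc< t<n))
                                                     (ℕₚ.*-distribˡ-+ (f t) _ _)))
                     (∑<-distrib-+ n _ _)

  motzkin-suc : ∀ n → motzkin (suc n) ≡ motzkin n + (motzkin ⋆ motzkin) n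
  motzkin-suc n = cong (motzkin n +_) (motzkinPrefix-suc n 0)

  -- Non-decreasing continuations of length k, with steps 0 or ≥ 2, rising by at most v in total:
  -- choose which s steps jump, then the jumps minus one form a composition of a number ≤ v − s.
  tailCount : ℕ → ℕ → ℕ
  tailCount k v = ∑< (suc k) (λ s → k C s * (v ∸ s) C s)

  tailCount-zero : ∀ v → tailCount 0 v ≡ 1
  tailCount-zero v = begin
    0 C 0 * v C 0  ≡⟨ cong₂ _*_ (nC0≡1 0) (nC0≡1 v) ⟩
    1              ∎

  ∑<-tailCount : ∀ k w → ∑< w (tailCount k) ≡ ∑< (suc k) (λ s → k C s * (w ∸ s) C suc s)
  ∑<-tailCount k w = begin
    ∑< w (λ u → ∑< (suc k) (λ s → k C s * (u ∸ s) C s))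
      ≡⟨ ∑<-comm w (suc k) _ ⟩
    ∑< (suc k) (λ s → ∑< w (λ u → k C s * (u ∸ s) C s))
      ≡⟨ ∑<-cong (suc k) (λ {s} _ → ∑<-distribˡ w (k C s) _) ⟩
    ∑< (suc k) (λ s → k C s * ∑< w (λ u → (u ∸ s) C s))
      ≡⟨ ∑<-cong (suc k) (λ {s} _ → cong (k C s *_) (∑<-hockey w s)) ⟩
    ∑< (suc k) (λ s → k C s * (w ∸ s) C suc s)
      ∎

  tailCount-suc : ∀ k v → tailCount (suc k) v ≡ tailCount k v + ∑< (v ∸ 1) (tailCount k)
  tailCount-suc k v = begin
    tailCount (suc k) v
      ≡⟨ ∑<-pascal k (λ s → (v ∸ s) C s) ⟩
    tailCount k v + ∑< (suc k) (λ s → k C s * (v ∸ suc s) C suc s)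
      ≡⟨ cong (tailCount k v +_)
              (∑<-cong (suc k) (λ {s} _ → cong (λ u → k C s * u C suc s) (sym (ℕₚ.∸-+-assoc v 1 s)))) ⟩
    tailCount k v + ∑< (suc k) (λ s → k C s * (v ∸ 1 ∸ s) C suc s)
      ≡⟨ cong (tailCount k v +_) (∑<-tailCount k (v ∸ 1)) ⟨
    tailCount k v + ∑< (v ∸ 1) (tailCount k)
      ∎

  ∑<-tailCount-trinomial : ∀ k → ∑< (suc k) (tailCount k) ≡ trinomial k 0 + trinomial k 1
  ∑<-tailCount-trinomial k = begin
    ∑< (suc k) (tailCount k)
      ≡⟨ ∑<-tailCount k (suc k) ⟩
    ∑< (suc k) (λ s → k C s * (suc k ∸ s) C suc s)
      ≡⟨ ∑<-cong (suc k) (λ {s} s<1+k → trans (cong (k C s *_) (C-suc-∸ s s<1+k))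
                                               (ℕₚ.*-distribˡ-+ (k C s) _ _)) ⟩
    ∑< (suc k) (λ s → k C s * (k ∸ s) C s + k C s * (k ∸ s) C suc s)
      ≡⟨ ∑<-distrib-+ (suc k) _ _ ⟩
    trinomial k 0 + trinomial k 1
      ∎

  private
    variable
      a p q : Level
      A B : Set a

  module _ {P : Pred A p} (P? : Decidable P) where

    length-filter-++ : ∀ xs ys → length (filter P? (xs ++ ys)) ≡ length (filter P? xs) + length (filter P? ys)
    length-filter-++ xs ys = trans (cong length (Listₚ.filter-++ P? xs ys)) (Listₚ.length-++ (filter P? xs))

    length-filter-map : ∀ (f : B → A) xs → length (filter P? (map f xs)) ≡ length (filter (P? ∘ f) xs)
    length-filter-map f []       = refl
    length-filter-map f (x ∷ xs) with P? (f x)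
    ... | yes _ = cong suc (length-filter-map f xs)
    ... | no  _ = length-filter-map f xs

    length-filter-concatMap : ∀ (f : B → List A) xs →
      length (filter P? (concatMap f xs)) ≡ sum (map (λ x → length (filter P? (f x))) xs)
    length-filter-concatMap f []       = refl
    length-filter-concatMap f (x ∷ xs) =
      trans (length-filter-++ (f x) (concatMap f xs)) (cong (_ +_) (length-filter-concatMap f xs))

    length-filter-none : ∀ {xs} → (∀ x → ¬ P x) → length (filter P? xs) ≡ 0
    length-filter-none {xs} ¬P = cong length (Listₚ.filter-none P? (universal ¬P xs))

  module _ {P : Pred A p} {Q : Pred A q} (P? : Decidable P) (Q? : Decidable Q) where

    filter-filter : ∀ xs → filter Q? (filter P? xs) ≡ filter (λ x → P? x ×-dec Q? x) xs
    filter-filter []       = refl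
    filter-filter (x ∷ xs) with P? x
    ... | no  _ = filter-filter xs
    ... | yes _ with Q? x
    ...   | yes _ = cong (x ∷_) (filter-filter xs)
    ...   | no  _ = filter-filter xs

  sum-map-range1 : ∀ (g : ℕ → ℕ) n → sum (map g (range1 n)) ≡ ∑< n (g ∘ suc)
  sum-map-range1 g zero    = refl
  sum-map-range1 g (suc n) = begin
    sum (map g (range1 n ++ suc n ∷ []))
      ≡⟨ cong sum (Listₚ.map-++ g (range1 n) (suc n ∷ [])) ⟩
    sum (map g (range1 n) ++ g (suc n) ∷ [])
      ≡⟨ sum-++ (map g (range1 n)) (g (suc n) ∷ []) ⟩
    sum (map g (range1 n)) + (g (suc n) + 0)
      ≡⟨ cong₂ _+_ (sum-map-range1 g n) (ℕₚ.+-identityʳ (g (suc n))) ⟩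
    ∑< n (g ∘ suc) + g (suc n)
      ∎

  length-filter-seqs-suc : ∀ {P : Pred (List ℕ) p} (P? : Decidable P) n k →
    length (filter P? (seqs n (suc k))) ≡ ∑< n (λ i → length (filter (P? ∘ (suc i ∷_)) (seqs n k)))
  length-filter-seqs-suc P? n k = begin
    length (filter P? (concatMap (λ x → map (x ∷_) (seqs n k)) (range1 n)))
      ≡⟨ length-filter-concatMap P? _ (range1 n) ⟩
    sum (map (λ x → length (filter P? (map (x ∷_) (seqs n k)))) (range1 n))
      ≡⟨ cong sum (Listₚ.map-cong (λ x → length-filter-map P? (x ∷_) (seqs n k)) (range1 n)) ⟩
    sum (map (λ x → length (filter (P? ∘ (x ∷_)) (seqs n k))) (range1 n))
      ≡⟨ sum-map-range1 _ n ⟩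
    ∑< n (λ i → length (filter (P? ∘ (suc i ∷_)) (seqs n k)))
      ∎

  module _ {R : ℕ → ℕ → Set p} (R? : ∀ x y → Dec (R x y)) {x y : ℕ} (ts : List (List ℕ)) where

    length-filter-linked-accept : R x y →
      length (filter (λ t → linked? R? (x ∷ y ∷ t)) ts) ≡ length (filter (λ t → linked? R? (y ∷ t)) ts)
    length-filter-linked-accept Rxy = cong length (Listₚ.filter-≐ _ _ (Linked.tail , (Rxy Linked.∷_)) ts)

    length-filter-linked-reject : ¬ R x y → length (filter (λ t → linked? R? (x ∷ y ∷ t)) ts) ≡ 0
    length-filter-linked-reject ¬Rxy =
      length-filter-none (λ t → linked? R? (x ∷ y ∷ t)) {ts} (λ t → ¬Rxy ∘ Linked.head)

  Good : ℕ → ℕ → Set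
  Good a b = a ≤ b × b ≢ suc a

  good? : ∀ a b → Dec (Good a b)
  good? a b = a ≤? b ×-dec ¬? (b ℕₚ.≟ suc a)

  m≡length-filter-linked-good : ∀ n → m n ≡ length (filter (linked? good?) (seqs n n))
  m≡length-filter-linked-good n = cong length (begin
    filter _ (filter (linked? _≤?_) (seqs n n))
      ≡⟨ filter-filter (linked? _≤?_) _ (seqs n n) ⟩
    filter _ (seqs n n)
      ≡⟨ Listₚ.filter-≐ _ (linked? good?) (Linked.zip , Linked.unzip) (seqs n n) ⟩
    filter (linked? good?) (seqs n n)
      ∎)

  ¬Good-< : ∀ {a b} → b < a → ¬ Good a b
  ¬Good-< b<a (a≤b , _) = ℕₚ.<⇒≱ b<a a≤b

  Good-refl : ∀ a → Good a a
  Good-refl a = ℕₚ.≤-refl , ℕₚ.1+n≢n ∘ sym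

  ¬Good-suc : ∀ a → ¬ Good a (suc a)
  ¬Good-suc a (_ , ≢) = ≢ refl

  Good-+2 : ∀ a j → Good a (a + suc (suc j))
  Good-+2 a j = ℕₚ.m≤m+n a _ , ℕₚ.m+1+n≢m a ∘ ℕₚ.suc-injective ∘ trans (sym (ℕₚ.+-suc a (suc j)))

  goodTails : ℕ → ℕ → ℕ → ℕ
  goodTails n k x = length (filter (λ t → linked? good? (x ∷ t)) (seqs n k))

  ∑<-good : ∀ x v (c F : ℕ → ℕ) →
    (∀ {i} → ¬ Good (suc x) (suc i) → c i ≡ 0) →
    (∀ {i} → i < x + suc v → Good (suc x) (suc i) → c i ≡ F (suc i)) →
    ∑< (x + suc v) c ≡ F (suc x) + ∑< (v ∸ 1) (λ j → F (suc x + suc (suc j)))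
  ∑<-good x v c F reject accept = begin
    ∑< (x + suc v) c
      ≡⟨ ∑<-split x (suc v) c ⟩
    ∑< x c + ∑< (suc v) (λ j → c (x + j))
      ≡⟨ cong (_+ ∑< (suc v) (λ j → c (x + j))) (∑<-zero x (λ i<x → reject (¬Good-< (s≤s i<x)))) ⟩
    ∑< (suc v) (λ j → c (x + j))
      ≡⟨ ∑<-sucˡ v (λ j → c (x + j)) ⟩
    c (x + 0) + ∑< v (λ j → c (x + suc j))
      ≡⟨ cong₂ _+_ here (above v ℕₚ.≤-refl) ⟩
    F (suc x) + ∑< (v ∸ 1) (λ j → F (suc x + suc (suc j)))
      ∎
    where
    here : c (x + 0) ≡ F (suc x)
    here = trans (cong c (ℕₚ.+-identityʳ x)) (accept (ℕₚ.m<m+n x (s≤s z≤n)) (Good-refl (suc x)))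
    above : ∀ w → w ≤ v → ∑< w (λ j → c (x + suc j)) ≡ ∑< (w ∸ 1) (λ j → F (suc x + suc (suc j)))
    above zero    _   = refl
    above (suc w) w<v = begin
      ∑< (suc w) (λ j → c (x + suc j))
        ≡⟨ ∑<-sucˡ w (λ j → c (x + suc j)) ⟩
      c (x + 1) + ∑< w (λ j → c (x + suc (suc j)))
        ≡⟨ cong₂ _+_ (trans (cong c (ℕₚ.+-comm x 1)) (reject (¬Good-suc (suc x))))
                     (∑<-cong w (λ {j} j<w → accept (bound j<w) (Good-+2 (suc x) j))) ⟩
      ∑< w (λ j → F (suc x + suc (suc j)))
        ∎
      where
      bound : ∀ {j} → j < w → x + suc (suc j) < x + suc v
      bound j<w = ℕₚ.+-monoʳ-< x (s≤s (ℕₚ.<-≤-trans (s≤s j<w) w<v))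

  goodTails≡tailCount : ∀ k {n x} → x < n → goodTails n k (suc x) ≡ tailCount k (n ∸ suc x)
  goodTails≡tailCount zero    _ = sym (tailCount-zero _)
  goodTails≡tailCount (suc k) {n} {x} x<n = begin
    goodTails n (suc k) (suc x)
      ≡⟨ length-filter-seqs-suc (λ t → linked? good? (suc x ∷ t)) n k ⟩
    ∑< n c
      ≡⟨ cong (λ l → ∑< l c) x+1+v≡n ⟨
    ∑< (x + suc v) c
      ≡⟨ ∑<-good x v c F (length-filter-linked-reject good? (seqs n k)) accept ⟩
    tailCount k v + ∑< (v ∸ 1) (λ j → F (suc x + suc (suc j)))
      ≡⟨ cong (tailCount k v +_) (∑<-cong (v ∸ 1) (λ {j} _ → cong (tailCount k) (index j))) ⟩
    tailCount k v + ∑< (v ∸ 1) (λ j → tailCount k (v ∸ 1 ∸ suc j))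
      ≡⟨ cong (tailCount k v +_) (∑<-reverse (v ∸ 1) (tailCount k)) ⟩
    tailCount k v + ∑< (v ∸ 1) (tailCount k)
      ≡⟨ tailCount-suc k v ⟨
    tailCount (suc k) v
      ∎
    where
    v : ℕ
    v = n ∸ suc x
    x+1+v≡n : x + suc v ≡ n
    x+1+v≡n = trans (ℕₚ.+-suc x v) (ℕₚ.m+[n∸m]≡n x<n)
    c F : ℕ → ℕ
    c i = length (filter (λ t → linked? good? (suc x ∷ suc i ∷ t)) (seqs n k))
    F y = tailCount k (n ∸ y)
    accept : ∀ {i} → i < x + suc v → Good (suc x) (suc i) → c i ≡ F (suc i)
    accept i<n g = trans (length-filter-linked-accept good? (seqs n k) g)
                         (goodTails≡tailCount k (subst (_ <_) x+1+v≡n i<n))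
    index : ∀ j → n ∸ (suc x + suc (suc j)) ≡ v ∸ 1 ∸ suc j
    index j = trans (sym (ℕₚ.∸-+-assoc n (suc x) (suc (suc j)))) (sym (ℕₚ.∸-+-assoc v 1 (suc j)))

  m-suc≡trinomial₀₁ : ∀ k → m (suc k) ≡ trinomial k 0 + trinomial k 1
  m-suc≡trinomial₀₁ k = begin
    m (suc k)
      ≡⟨ m≡length-filter-linked-good (suc k) ⟩
    length (filter (linked? good?) (seqs (suc k) (suc k)))
      ≡⟨ length-filter-seqs-suc (linked? good?) (suc k) k ⟩
    ∑< (suc k) (λ i → goodTails (suc k) k (suc i))
      ≡⟨ ∑<-cong (suc k) (goodTails≡tailCount k) ⟩
    ∑< (suc k) (λ i → tailCount k (k ∸ i))
      ≡⟨ ∑<-reverse (suc k) (tailCount k) ⟩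
    ∑< (suc k) (tailCount k)
      ≡⟨ ∑<-tailCount-trinomial k ⟩
    trinomial k 0 + trinomial k 1
      ∎

  m-suc-suc : ∀ k → m (suc (suc k)) + motzkin k ≡ 3 * m (suc k)
  m-suc-suc k = begin
    m (suc (suc k)) + motzkin k                           ≡⟨ cong (_+ motzkin k) (m-suc≡trinomial₀₁ (suc k)) ⟩
    trinomial (suc k) 0 + trinomial (suc k) 1 + motzkin k ≡⟨ trinomial₀₁-suc k ⟩
    3 * (trinomial k 0 + trinomial k 1)                   ≡⟨ cong (3 *_) (m-suc≡trinomial₀₁ k) ⟨
    3 * m (suc k)                                         ∎

open Combinatorics using (motzkin; motzkin-suc; m-suc-suc)

open import Data.Rational as ℚ using (ℚ; 0ℚ; 1ℚ; ½; _+_; _*_; _-_; -_; 1/_; mkℚ)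
open import Data.Rational.Solver using (module +-*-Solver)
open +-*-Solver using (solve; _:+_; _:*_; _:-_; :-_; _:=_; con)

ℚ-semiring : CommutativeSemiring _ _
ℚ-semiring = CommutativeRing.commutativeSemiring ℚₚ.+-*-commutativeRing

module ℚΣ = Summation ℚ-semiring

open ≡-Reasoning

open import Algebra.Properties.CommutativeSemigroup
  (CommutativeMonoid.commutativeSemigroup ℚₚ.*-1-commutativeMonoid) using (x∙yz≈y∙xz)
open import Algebra.Properties.Semiring.Mult (CommutativeSemiring.semiring ℚ-semiring)
  using (_×_; ×-homo-+; ×1-homo-*)

fromℕ-suc : ∀ n → fromℕ (suc n) ≡ 1ℚ + fromℕ n
fromℕ-suc n = sym (begin
  1ℚ + fromℕ n
    ≡⟨ cong (1ℚ +_) (ℚₚ.normalize-coprime 1-coprime) ⟩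
  1ℚ + mkℚ (ℤ.+ n) 0 1-coprime
    ≡⟨ cong (λ k → (ℤ.+ 1 ℤ.+ k) ℚ./ 1) (trans (ℤₚ.+◃n≡+n (n ℕ.* 1)) (cong ℤ.+_ (ℕₚ.*-identityʳ n))) ⟩
  fromℕ (suc n)
    ∎)
  where
  1-coprime = Coprimality.sym (Coprimality.1-coprimeTo n)

fromℕ≡×1 : ∀ n → fromℕ n ≡ n × 1ℚ
fromℕ≡×1 zero    = refl
fromℕ≡×1 (suc n) = trans (fromℕ-suc n) (cong (1ℚ +_) (fromℕ≡×1 n))

fromℕ-+ : ∀ a b → fromℕ (a ℕ.+ b) ≡ fromℕ a + fromℕ b
fromℕ-+ a b = begin
  fromℕ (a ℕ.+ b)        ≡⟨ fromℕ≡×1 (a ℕ.+ b) ⟩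
  (a ℕ.+ b) × 1ℚ         ≡⟨ ×-homo-+ 1ℚ a b ⟩
  a × 1ℚ + b × 1ℚ        ≡⟨ cong₂ _+_ (fromℕ≡×1 a) (fromℕ≡×1 b) ⟨
  fromℕ a + fromℕ b      ∎

fromℕ-* : ∀ a b → fromℕ (a ℕ.* b) ≡ fromℕ a * fromℕ b
fromℕ-* a b = begin
  fromℕ (a ℕ.* b)        ≡⟨ fromℕ≡×1 (a ℕ.* b) ⟩
  (a ℕ.* b) × 1ℚ         ≡⟨ ×1-homo-* a b ⟩
  a × 1ℚ * b × 1ℚ        ≡⟨ cong₂ _*_ (fromℕ≡×1 a) (fromℕ≡×1 b) ⟨
  fromℕ a * fromℕ b      ∎

fromℕ-∑< : ∀ n f → fromℕ (ℕΣ.∑< n f) ≡ ℚΣ.∑< n (fromℕ ∘ f)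
fromℕ-∑< zero    f = refl
fromℕ-∑< (suc n) f = trans (fromℕ-+ (ℕΣ.∑< n f) (f n)) (cong (_+ fromℕ (f n)) (fromℕ-∑< n f))

fromℕ-⋆ : ∀ f g n → fromℕ ((f ℕΣ.⋆ g) n) ≡ ((fromℕ ∘ f) ℚΣ.⋆ (fromℕ ∘ g)) n
fromℕ-⋆ f g n = trans (fromℕ-∑< n _) (ℚΣ.∑<-cong n (λ {t} _ → fromℕ-* (f t) (g (n ∸ suc t))))

sum1To≡∑< : ∀ n f → sum1To n f ≡ ℚΣ.∑< n (f ∘ suc)
sum1To≡∑< zero    f = refl
sum1To≡∑< (suc n) f = cong (_+ f (suc n)) (sum1To≡∑< n f)

sum1To-cong : ∀ n {f g} → (∀ {i} → i < n → f (suc i) ≡ g (suc i)) → sum1To n f ≡ sum1To n g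
sum1To-cong n {f} {g} f≡g = trans (sum1To≡∑< n f) (trans (ℚΣ.∑<-cong n f≡g) (sym (sum1To≡∑< n g)))

sumTo-cong : ∀ n {f g} → (∀ {i} → i ≤ n → f i ≡ g i) → sumTo n f ≡ sumTo n g
sumTo-cong zero    f≡g = f≡g z≤n
sumTo-cong (suc n) f≡g = cong₂ _+_ (sumTo-cong n (f≡g ∘ ℕₚ.m≤n⇒m≤1+n)) (f≡g ℕₚ.≤-refl)

sumTo-distribˡ : ∀ n x f → sumTo n (λ i → x * f i) ≡ x * sumTo n f
sumTo-distribˡ zero    x f = refl
sumTo-distribˡ (suc n) x f =
  trans (cong (_+ x * f (suc n)) (sumTo-distribˡ n x f)) (sym (ℚₚ.*-distribˡ-+ x _ _))

module SnocFamily (L : ℕ → List ℚ) (new : ℕ → ℚ) (L-zero : length (L 0) ≡ 1)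
            (L-suc : ∀ n → L (suc n) ≡ L n ++ new n ∷ []) where

  private
    at-++-< : ∀ xs y {i} → i < length xs → at (xs ++ y ∷ []) i ≡ at xs i
    at-++-< (x ∷ xs) y {zero}  _         = refl
    at-++-< (x ∷ xs) y {suc i} (s≤s i<n) = at-++-< xs y i<n

    at-++-length : ∀ xs y → at (xs ++ y ∷ []) (length xs) ≡ y
    at-++-length []       y = refl
    at-++-length (x ∷ xs) y = at-++-length xs y

    length-++-[] : ∀ (xs : List ℚ) y → length (xs ++ y ∷ []) ≡ suc (length xs)
    length-++-[] []       y = refl
    length-++-[] (x ∷ xs) y = cong suc (length-++-[] xs y)

    length-L : ∀ n → length (L n) ≡ suc n
    length-L zero    = L-zero
    length-L (suc n) = trans (cong length (L-suc n)) (trans (length-++-[] (L n) (new n)) (cong suc (length-L n)))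

  at-L-suc : ∀ n → at (L (suc n)) (suc n) ≡ new n
  at-L-suc n = begin
    at (L (suc n)) (suc n)               ≡⟨ cong₂ at (L-suc n) (sym (length-L n)) ⟩
    at (L n ++ new n ∷ []) (length (L n)) ≡⟨ at-++-length (L n) (new n) ⟩
    new n                                ∎

  at-L : ∀ {n i} → i ≤ n → at (L n) i ≡ at (L i) i
  at-L {zero}  z≤n = refl
  at-L {suc n} {i} i≤1+n with ℕₚ.m≤n⇒m<n∨m≡n i≤1+n
  ... | inj₂ refl      = refl
  ... | inj₁ (s≤s i≤n) = begin
    at (L (suc n)) i           ≡⟨ cong (λ xs → at xs i) (L-suc n) ⟩
    at (L n ++ new n ∷ []) i   ≡⟨ at-++-< (L n) (new n) (subst (i <_) (sym (length-L n)) (s≤s i≤n)) ⟩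
    at (L n) i                 ≡⟨ at-L i≤n ⟩
    at (L i) i                 ∎

sqrtS-suc : ∀ a n → sqrtS a (suc n) ≡ ½ * (a (suc n) - sum1To n (λ i → sqrtS a i * sqrtS a (suc n ∸ i)))
sqrtS-suc a n = trans (at-L-suc n) (cong (λ z → ½ * (a (suc n) - z))
  (sum1To-cong n (λ {j} j<n → cong₂ _*_ (at-L j<n) (at-L (ℕₚ.m∸n≤m n j)))))
  where
  new : ℕ → ℚ
  new n = ½ * (a (suc n) - sum1To n (λ i → at (sqrtUpTo a n) i * at (sqrtUpTo a n) (suc n ∸ i)))
  open SnocFamily (sqrtUpTo a) new refl (λ _ → refl)

sqrtS-unique : ∀ a (s : Series) → s 0 ≡ 1ℚ →
  (∀ n → s (suc n) ≡ ½ * (a (suc n) - sum1To n (λ i → s i * s (suc n ∸ i)))) →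
  ∀ n → sqrtS a n ≡ s n
sqrtS-unique a s s₀ s-suc = <-rec _ step
  where
  step : ∀ n → (∀ {i} → i < n → sqrtS a i ≡ s i) → sqrtS a n ≡ s n
  step zero    _  = sym s₀
  step (suc n) ih = begin
    sqrtS a (suc n)
      ≡⟨ sqrtS-suc a n ⟩
    ½ * (a (suc n) - sum1To n (λ i → sqrtS a i * sqrtS a (suc n ∸ i)))
      ≡⟨ cong (λ z → ½ * (a (suc n) - z))
              (sum1To-cong n (λ {j} j<n → cong₂ _*_ (ih (s≤s j<n)) (ih (s≤s (ℕₚ.m∸n≤m n j))))) ⟩
    ½ * (a (suc n) - sum1To n (λ i → s i * s (suc n ∸ i)))
      ≡⟨ s-suc n ⟨
    s (suc n)
      ∎

invS-suc : ∀ b .{{_ : ℚ.NonZero (b 0)}} n →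
  invS b (suc n) ≡ - (1/ b 0) * sum1To (suc n) (λ i → b i * invS b (suc n ∸ i))
invS-suc b n = trans (at-L-suc n) (cong (- (1/ b 0) *_)
  (sum1To-cong (suc n) (λ {j} _ → cong (b (suc j) *_) (at-L (ℕₚ.m∸n≤m n j)))))
  where
  new : ℕ → ℚ
  new n = - (1/ b 0) * sum1To (suc n) (λ i → b i * at (invUpTo b n) (suc n ∸ i))
  open SnocFamily (invUpTo b) new refl (λ _ → refl)

invS-linear : ∀ b₀ b₁ .{{_ : ℚ.NonZero b₀}} n →
  invS (poly (b₀ ∷ b₁ ∷ [])) (suc n) ≡ (- (1/ b₀) * b₁) * invS (poly (b₀ ∷ b₁ ∷ [])) n
invS-linear b₀ b₁ n = begin
  invS b (suc n)
    ≡⟨ invS-suc b n ⟩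
  - (1/ b₀) * sum1To (suc n) (λ i → b i * invS b (suc n ∸ i))
    ≡⟨ cong (- (1/ b₀) *_) (only-first n) ⟩
  - (1/ b₀) * (b₁ * invS b n)
    ≡⟨ ℚₚ.*-assoc (- (1/ b₀)) b₁ (invS b n) ⟨
  (- (1/ b₀) * b₁) * invS b n
    ∎
  where
  b : Series
  b = poly (b₀ ∷ b₁ ∷ [])
  only-first : ∀ k → sum1To (suc k) (λ i → b i * invS b (suc n ∸ i)) ≡ b₁ * invS b n
  only-first zero    = ℚₚ.+-identityˡ _
  only-first (suc k) =
    trans (cong₂ _+_ (only-first k) (ℚₚ.*-zeroˡ (invS b (n ∸ suc k)))) (ℚₚ.+-identityʳ _)

⊛-geometricʳ : ∀ f g r → (∀ i → g (suc i) ≡ r * g i) →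
  ∀ n → (f ⊛ g) (suc n) ≡ r * (f ⊛ g) n + f (suc n) * g 0
⊛-geometricʳ f g r g-suc n = cong₂ _+_
  (trans (sumTo-cong n (λ {i} i≤n → trans (cong (λ j → f i * g j) (ℕₚ.+-∸-assoc 1 i≤n))
           (trans (cong (f i *_) (g-suc (n ∸ i))) (x∙yz≈y∙xz (f i) r (g (n ∸ i))))))
         (sumTo-distribˡ n r _))
  (cong (λ j → f (suc n) * g j) (ℕₚ.n∸n≡0 n))

-- √(1 − 2z − 3z²) = 1 − z − 2 Σₖ Mₖ z^(k+2), with Mₖ the Motzkin numbers.
motzkinRoot : Series
motzkinRoot zero          = 1ℚ
motzkinRoot (suc zero)    = - 1ℚ
motzkinRoot (suc (suc k)) = - (fromℕ 2 * fromℕ (motzkin k))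

Δ : Series
Δ = poly (1ℚ ∷ - fromℕ 2 ∷ - fromℕ 3 ∷ [])

motzkinRoot-suc : ∀ n →
  motzkinRoot (suc n) ≡ ½ * (Δ (suc n) - sum1To n (λ i → motzkinRoot i * motzkinRoot (suc n ∸ i)))
motzkinRoot-suc zero          = refl
motzkinRoot-suc (suc zero)    = refl
motzkinRoot-suc (suc (suc j)) = sym (begin
  ½ * (0ℚ - sum1To (suc (suc j)) h)
    ≡⟨ cong (λ z → ½ * (0ℚ - z)) (sum1To≡∑< (suc (suc j)) h) ⟩
  ½ * (0ℚ - (ℚΣ.∑< (suc j) (h ∘ suc) + h (suc (suc j))))
    ≡⟨ cong (λ z → ½ * (0ℚ - (z + h (suc (suc j))))) (ℚΣ.∑<-sucˡ j (h ∘ suc)) ⟩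
  ½ * (0ℚ - ((h 1 + ℚΣ.∑< j (h ∘ suc ∘ suc)) + h (suc (suc j))))
    ≡⟨ cong₂ (λ y z → ½ * (0ℚ - ((h 1 + y) + r (suc (suc j)) * r z))) middle (ℕₚ.m+n∸n≡m 1 j) ⟩
  ½ * (0ℚ - ((h 1 + fromℕ 4 * y) + r (suc (suc j)) * r 1))
    ≡⟨ solve 2 (λ x y → con ½ :* (con 0ℚ :- ((con (- 1ℚ) :* :- (con (fromℕ 2) :* x) :+ con (fromℕ 4) :* y)
                                             :+ :- (con (fromℕ 2) :* x) :* con (- 1ℚ)))
                        := :- (con (fromℕ 2) :* (x :+ y))) refl x y ⟩
  - (fromℕ 2 * (x + y))
    ≡⟨ cong (λ z → - (fromℕ 2 * z)) (trans (sym (fromℕ-+ (motzkin j) _)) (cong fromℕ (sym (motzkin-suc j)))) ⟩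
  r (suc (suc (suc j)))
    ∎)
  where
  r : Series
  r = motzkinRoot
  h : ℕ → ℚ
  h i = r i * r (suc (suc (suc j)) ∸ i)
  x y : ℚ
  x = fromℕ (motzkin j)
  y = fromℕ ((motzkin ℕΣ.⋆ motzkin) j)
  middle : ℚΣ.∑< j (h ∘ suc ∘ suc) ≡ fromℕ 4 * y
  middle = begin
    ℚΣ.∑< j (λ t → r (suc (suc t)) * r (suc j ∸ t))
      ≡⟨ ℚΣ.∑<-cong j (λ {t} t<j → trans (cong (λ i → r (suc (suc t)) * r i) (index t<j))
                                          (product (motzkin t) (motzkin (j ∸ suc t)))) ⟩
    ℚΣ.∑< j (λ t → fromℕ 4 * (fromℕ (motzkin t) * fromℕ (motzkin (j ∸ suc t))))
      ≡⟨ ℚΣ.∑<-distribˡ j (fromℕ 4) _ ⟩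
    fromℕ 4 * ((fromℕ ∘ motzkin) ℚΣ.⋆ (fromℕ ∘ motzkin)) j
      ≡⟨ cong (fromℕ 4 *_) (fromℕ-⋆ motzkin motzkin j) ⟨
    fromℕ 4 * y
      ∎
    where
    index : ∀ {t} → t < j → suc j ∸ t ≡ suc (suc (j ∸ suc t))
    index {t} t<j = trans (ℕₚ.+-∸-assoc 1 (ℕₚ.<⇒≤ t<j)) (cong suc (ℕₚ.+-∸-assoc 1 t<j))
    product : ∀ a b → - (fromℕ 2 * fromℕ a) * - (fromℕ 2 * fromℕ b) ≡ fromℕ 4 * (fromℕ a * fromℕ b)
    product a b = solve 2 (λ a b → :- (con (fromℕ 2) :* a) :* :- (con (fromℕ 2) :* b) := con (fromℕ 4) :* (a :* b))
                          refl (fromℕ a) (fromℕ b)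

sqrtS-Δ : ∀ n → sqrtS Δ n ≡ motzkinRoot n
sqrtS-Δ = sqrtS-unique Δ motzkinRoot refl motzkinRoot-suc

1-3z 6z-2 : Series
1-3z = poly (1ℚ ∷ - fromℕ 3 ∷ [])
6z-2 = poly (- fromℕ 2 ∷ fromℕ 6 ∷ [])

forcing : ℕ → ℚ
forcing n = (1-3z (suc n) - sqrtS Δ (suc n)) * invS 6z-2 0

rhs-suc : ∀ n → rhs (suc n) ≡ fromℕ 3 * rhs n + forcing n
rhs-suc = ⊛-geometricʳ (1-3z ⊖ sqrtS Δ) (invS 6z-2) (fromℕ 3) (invS-linear (- fromℕ 2) (fromℕ 6))

lhs-suc : ∀ n → lhs (suc n) ≡ fromℕ 3 * lhs n + forcing n
lhs-suc zero    = refl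
lhs-suc (suc k) = sym (begin
  fromℕ 3 * fromℕ (m (suc k)) + (0ℚ - sqrtS Δ (suc (suc k))) * invS 6z-2 0
    ≡⟨ cong₂ (λ u v → u + (0ℚ - v) * invS 6z-2 0) three-m (sqrtS-Δ (suc (suc k))) ⟩
  (X + Y) + (0ℚ - - (fromℕ 2 * Y)) * invS 6z-2 0
    ≡⟨ solve 2 (λ X Y → (X :+ Y) :+ (con 0ℚ :- (:- (con (fromℕ 2) :* Y))) :* con (invS 6z-2 0) := X)
               refl X Y ⟩
  X
    ∎)
  where
  X Y : ℚ
  X = fromℕ (m (suc (suc k)))
  Y = fromℕ (motzkin k)
  three-m : fromℕ 3 * fromℕ (m (suc k)) ≡ X + Y
  three-m = begin
    fromℕ 3 * fromℕ (m (suc k))         ≡⟨ fromℕ-* 3 (m (suc k)) ⟨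
    fromℕ (3 ℕ.* m (suc k))             ≡⟨ cong fromℕ (m-suc-suc k) ⟨
    fromℕ (m (suc (suc k)) ℕ.+ motzkin k) ≡⟨ fromℕ-+ (m (suc (suc k))) (motzkin k) ⟩
    X + Y                               ∎

theorem3 : ∀ n → lhs n ≡ rhs n
theorem3 zero    = refl
theorem3 (suc n) = begin
  lhs (suc n)                   ≡⟨ lhs-suc n ⟩
  fromℕ 3 * lhs n + forcing n   ≡⟨ cong (λ x → fromℕ 3 * x + forcing n) (theorem3 n) ⟩
  fromℕ 3 * rhs n + forcing n   ≡⟨ rhs-suc n ⟨
  rhs (suc n)                   ∎
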